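{- Let $A$ be a finite alphabet, $X$ a set, and $(o,\delta):X\to\mathbb{B}\times\mathcal{P}_\omega(X^*)^A$, with extension $(\mathcal{P}_\omega(X^*),(\hat o,\hat\delta))$. Then for all finite languages $S,T\in\mathcal{P}_\omega(X^*)$ and all $a\in A$: $\hat o(ST)=\hat o(S)\wedge\hat o(T)$ and $(ST)_a=S_aT\cup i(\hat o(S))T_a$.
   Context: $\mathbb{B}=\{0,1\}$ is the Boolean semiring; $\mathcal{P}_\omega(X^*)$ is the set of finite sets of words over $X$, with concatenation $ST=\{st\mid s\in S,t\in T\}$. Write $x_a:=\delta(x)(a)$ and $S_a:=\hat\delta(S)(a)$. $i:\mathbb{B}\to\mathcal{P}(X^*)$ is $i(1)=\{\epsilon\}$, $i(0)=\emptyset$. The extension is defined inductively: $\hat o(\{\epsilon\})=1$, $\{\epsilon\}_a=\emptyset$; for $x\in X$, $w\in X^*$: $\hat o(\{xw\})=o(x)\wedge\hat o(\{w\})$, $\{xw\}_a=x_a\{w\}\cup i(o(x))\{w\}_a$; for finite $S$: $\hat o(S)=\bigvee_{s\in S}\hat o(\{s\})$, $S_a=\bigcup_{s\in S}\{s\}_a$. -}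

module Defs where

open import Data.Bool using (Bool; true; false; _∧_; _∨_)
open import Data.Nat using (ℕ)
open import Data.Fin using (Fin)
open import Data.List using (List; []; _∷_; _++_; map; concatMap; foldr)
open import Data.List.Membership.Propositional using (_∈_)
open import Data.Product using (∃)
open import Function.Bundles using (_⇔_; _↔_)

-- Words over X are lists; finite languages P_ω(X*) are represented by
-- finite lists of words, compared up to having the same members.
Word : Set → Set
Word X = List X

Lang : Set → Set
Lang X = List (Word X)

Finite : Set → Set
Finite A = ∃ λ n → A ↔ Fin n

_≈L_ : {X : Set} → Lang X → Lang X → Set
S ≈L T = ∀ w → (w ∈ S) ⇔ (w ∈ T)

_∪L_ : {X : Set} → Lang X → Lang X → Lang X
S ∪L T = S ++ T

_·L_ : {X : Set} → Lang X → Lang X → Lang X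
S ·L T = concatMap (λ s → map (s ++_) T) S

iL : {X : Set} → Bool → Lang X
iL true  = [] ∷ []
iL false = []

⟦_⟧ : {X : Set} → Word X → Lang X
⟦ w ⟧ = w ∷ []

module Extension {A X : Set} (o : X → Bool) (δ : X → A → Lang X) where

  ô-word : Word X → Bool
  ô-word []      = true
  ô-word (x ∷ w) = o x ∧ ô-word w

  δ-word : Word X → A → Lang X
  δ-word []      a = []
  δ-word (x ∷ w) a = (δ x a ·L ⟦ w ⟧) ∪L (iL (o x) ·L δ-word w a)

  ô : Lang X → Bool
  ô S = foldr _∨_ false (map ô-word S)

  δ̂ : Lang X → A → Lang X
  δ̂ S a = concatMap (λ s → δ-word s a) S

-- Everything reduces to the single-word case {st}_a = {s}_a{t} ∪ i(ô{s}){t}_a,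
-- proved by induction on s using the associativity of concatenation of
-- languages.  Since ô and δ̂ act on a finite language word by word, the
-- statement for ST = {st | s ∈ S, t ∈ T} then follows by comparing members:
-- a derivative of st either comes from a derivative of s followed by t, or,
-- when s is accepting, is a derivative of t.
module Submission where

open import Defs
open import Data.Bool using (Bool; true; false; T; _∧_; _∨_)
open import Data.Bool.Properties using (∧-assoc; ∨-assoc; ∧-zeroʳ; ∧-distribˡ-∨; ∧-distribʳ-∨)
open import Data.Product using (_×_; _,_; ∃; ∃₂)
open import Data.Sum using (inj₁; inj₂)
open import Data.List using (List; []; _∷_; _++_; map; concatMap; cartesianProductWith)
open import Data.List.Properties using (++-assoc; ++-identityʳ; map-id; map-++; map-∘; concatMap-++)
open import Data.List.Membership.Propositional using (_∈_; find; lose)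
open import Data.List.Membership.Propositional.Properties
  using (∈-++⁺ˡ; ∈-++⁺ʳ; ∈-++⁻; ∈-concatMap⁺; ∈-concatMap⁻; ∈-cartesianProductWith⁺; ∈-cartesianProductWith⁻)
open import Data.List.Relation.Unary.Any using (here)
open import Data.List.Relation.Unary.Any.Properties using (any⁺; any⁻)
open import Function.Bundles using (mk⇔)
open import Relation.Binary.PropositionalEquality using (_≡_; refl; sym; trans; cong; cong₂; subst; module ≡-Reasoning)

∈-concatMap⁺′ : {B C : Set} (f : B → List C) {xs : List B} {x : B} {y : C} →
                x ∈ xs → y ∈ f x → y ∈ concatMap f xs
∈-concatMap⁺′ f x∈xs y∈fx = ∈-concatMap⁺ f (lose x∈xs y∈fx)

∈-concatMap⁻′ : {B C : Set} (f : B → List C) {xs : List B} {y : C} →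
                y ∈ concatMap f xs → ∃ λ x → x ∈ xs × y ∈ f x
∈-concatMap⁻′ f y∈ = find (∈-concatMap⁻ f y∈)

module _ {X : Set} where

  ·L-cartesianProduct : (S T : Lang X) → S ·L T ≡ cartesianProductWith _++_ S T
  ·L-cartesianProduct []      T = refl
  ·L-cartesianProduct (s ∷ S) T = cong (map (s ++_) T ++_) (·L-cartesianProduct S T)

  ∈-·L⁺ : {S T : Lang X} {s t : Word X} → s ∈ S → t ∈ T → s ++ t ∈ S ·L T
  ∈-·L⁺ {S} {T} s∈S t∈T =
    subst (_ ∈_) (sym (·L-cartesianProduct S T)) (∈-cartesianProductWith⁺ _++_ s∈S t∈T)

  ∈-·L⁻ : {S T : Lang X} {w : Word X} → w ∈ S ·L T →
          ∃₂ λ s t → s ∈ S × t ∈ T × w ≡ s ++ t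
  ∈-·L⁻ {S} {T} w∈ST =
    ∈-cartesianProductWith⁻ _++_ S T (subst (_ ∈_) (·L-cartesianProduct S T) w∈ST)

  ·L-distribʳ-++ : (L M N : Lang X) → (L ++ M) ·L N ≡ (L ·L N) ++ (M ·L N)
  ·L-distribʳ-++ L M N = concatMap-++ (λ l → map (l ++_) N) L M

  map-++ˡ-·L : (u : Word X) (M N : Lang X) → map (u ++_) M ·L N ≡ map (u ++_) (M ·L N)
  map-++ˡ-·L u []      N = refl
  map-++ˡ-·L u (m ∷ M) N = begin
    map ((u ++ m) ++_) N ++ (map (u ++_) M ·L N)
      ≡⟨ cong₂ _++_ (trans (map-cong-++-assoc N) (map-∘ N)) (map-++ˡ-·L u M N) ⟩
    map (u ++_) (map (m ++_) N) ++ map (u ++_) (M ·L N)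
      ≡⟨ sym (map-++ (u ++_) (map (m ++_) N) (M ·L N)) ⟩
    map (u ++_) (map (m ++_) N ++ (M ·L N)) ∎
    where
    open ≡-Reasoning
    map-cong-++-assoc : (N : Lang X) → map ((u ++ m) ++_) N ≡ map (λ n → u ++ (m ++ n)) N
    map-cong-++-assoc []      = refl
    map-cong-++-assoc (n ∷ N) = cong₂ _∷_ (++-assoc u m n) (map-cong-++-assoc N)

  ·L-assoc : (L M N : Lang X) → (L ·L M) ·L N ≡ L ·L (M ·L N)
  ·L-assoc []      M N = refl
  ·L-assoc (l ∷ L) M N = begin
    (map (l ++_) M ++ (L ·L M)) ·L N     ≡⟨ ·L-distribʳ-++ (map (l ++_) M) (L ·L M) N ⟩
    (map (l ++_) M ·L N) ++ ((L ·L M) ·L N)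
      ≡⟨ cong₂ _++_ (map-++ˡ-·L l M N) (·L-assoc L M N) ⟩
    map (l ++_) (M ·L N) ++ (L ·L (M ·L N)) ∎
    where open ≡-Reasoning

  iL-true-·L : (M : Lang X) → iL true ·L M ≡ M
  iL-true-·L M = trans (++-identityʳ (map (λ w → w) M)) (map-id M)

  ∈-iL-·L⁺ : {b : Bool} {M : Lang X} {w : Word X} → T b → w ∈ M → w ∈ iL b ·L M
  ∈-iL-·L⁺ {true} {M} _ w∈M = subst (_ ∈_) (sym (iL-true-·L M)) w∈M

  ∈-iL-·L⁻ : {b : Bool} {M : Lang X} {w : Word X} → w ∈ iL b ·L M → T b × w ∈ M
  ∈-iL-·L⁻ {true} {M} w∈ = _ , subst (_ ∈_) (iL-true-·L M) w∈

module _ {A X : Set} (o : X → Bool) (δ : X → A → Lang X) where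
  open Extension {A} o δ

  ô-word-++ : (s t : Word X) → ô-word (s ++ t) ≡ ô-word s ∧ ô-word t
  ô-word-++ []      t = refl
  ô-word-++ (x ∷ s) t =
    trans (cong (o x ∧_) (ô-word-++ s t)) (sym (∧-assoc (o x) (ô-word s) (ô-word t)))

  ô-++ : (L M : Lang X) → ô (L ++ M) ≡ ô L ∨ ô M
  ô-++ []      M = refl
  ô-++ (l ∷ L) M = trans (cong (ô-word l ∨_) (ô-++ L M)) (sym (∨-assoc (ô-word l) (ô L) (ô M)))

  ô-map-++ˡ : (s : Word X) (T : Lang X) → ô (map (s ++_) T) ≡ ô-word s ∧ ô T
  ô-map-++ˡ s []      = sym (∧-zeroʳ (ô-word s))
  ô-map-++ˡ s (t ∷ T) = trans (cong₂ _∨_ (ô-word-++ s t) (ô-map-++ˡ s T))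
                              (sym (∧-distribˡ-∨ (ô-word s) (ô-word t) (ô T)))

  ô-·L : (S T : Lang X) → ô (S ·L T) ≡ ô S ∧ ô T
  ô-·L []      T = refl
  ô-·L (s ∷ S) T = begin
    ô (map (s ++_) T ++ (S ·L T))        ≡⟨ ô-++ (map (s ++_) T) (S ·L T) ⟩
    ô (map (s ++_) T) ∨ ô (S ·L T)       ≡⟨ cong₂ _∨_ (ô-map-++ˡ s T) (ô-·L S T) ⟩
    (ô-word s ∧ ô T) ∨ (ô S ∧ ô T)       ≡⟨ sym (∧-distribʳ-∨ (ô T) (ô-word s) (ô S)) ⟩
    (ô-word s ∨ ô S) ∧ ô T               ∎
    where open ≡-Reasoning

  -- ô S is definitionally any ô-word S.
  T-ô⁺ : {S : Lang X} {s : Word X} → s ∈ S → T (ô-word s) → T (ô S)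
  T-ô⁺ s∈S accepting = any⁺ ô-word (lose s∈S accepting)

  T-ô⁻ : (S : Lang X) → T (ô S) → ∃ λ s → s ∈ S × T (ô-word s)
  T-ô⁻ S accepting = find (any⁻ ô-word S accepting)

  δ-word-++ : (s t : Word X) (a : A) →
              δ-word (s ++ t) a ≡ (δ-word s a ·L ⟦ t ⟧) ∪L (iL (ô-word s) ·L δ-word t a)
  δ-word-++ []      t a = sym (iL-true-·L (δ-word t a))
  δ-word-++ (x ∷ s) t a with o x
  ... | true = begin
    (δ x a ·L ⟦ s ++ t ⟧) ++ (iL true ·L δ-word (s ++ t) a)
      ≡⟨ cong ((δ x a ·L ⟦ s ++ t ⟧) ++_) (trans (iL-true-·L _) (δ-word-++ s t a)) ⟩
    (δ x a ·L ⟦ s ++ t ⟧) ++ ((δ-word s a ·L ⟦ t ⟧) ++ rest)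
      ≡⟨ sym (++-assoc (δ x a ·L ⟦ s ++ t ⟧) _ rest) ⟩
    ((δ x a ·L ⟦ s ++ t ⟧) ++ (δ-word s a ·L ⟦ t ⟧)) ++ rest
      ≡⟨ cong (λ L → (L ++ (δ-word s a ·L ⟦ t ⟧)) ++ rest) (sym (·L-assoc (δ x a) ⟦ s ⟧ ⟦ t ⟧)) ⟩
    (((δ x a ·L ⟦ s ⟧) ·L ⟦ t ⟧) ++ (δ-word s a ·L ⟦ t ⟧)) ++ rest
      ≡⟨ cong (_++ rest) (sym (·L-distribʳ-++ (δ x a ·L ⟦ s ⟧) (δ-word s a) ⟦ t ⟧)) ⟩
    (((δ x a ·L ⟦ s ⟧) ++ δ-word s a) ·L ⟦ t ⟧) ++ rest
      ≡⟨ cong (λ L → (((δ x a ·L ⟦ s ⟧) ++ L) ·L ⟦ t ⟧) ++ rest) (sym (iL-true-·L _)) ⟩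
    (((δ x a ·L ⟦ s ⟧) ++ (iL true ·L δ-word s a)) ·L ⟦ t ⟧) ++ rest ∎
    where
    open ≡-Reasoning
    rest : Lang X
    rest = iL (ô-word s) ·L δ-word t a
  ... | false = begin
    (δ x a ·L ⟦ s ++ t ⟧) ++ []           ≡⟨ ++-identityʳ (δ x a ·L ⟦ s ++ t ⟧) ⟩
    δ x a ·L ⟦ s ++ t ⟧                   ≡⟨ sym (·L-assoc (δ x a) ⟦ s ⟧ ⟦ t ⟧) ⟩
    (δ x a ·L ⟦ s ⟧) ·L ⟦ t ⟧             ≡⟨ cong (_·L ⟦ t ⟧) (sym (++-identityʳ (δ x a ·L ⟦ s ⟧))) ⟩
    ((δ x a ·L ⟦ s ⟧) ++ []) ·L ⟦ t ⟧     ≡⟨ sym (++-identityʳ (((δ x a ·L ⟦ s ⟧) ++ []) ·L ⟦ t ⟧)) ⟩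
    (((δ x a ·L ⟦ s ⟧) ++ []) ·L ⟦ t ⟧) ++ [] ∎
    where open ≡-Reasoning

  δ̂-·L : (S T : Lang X) (a : A) → δ̂ (S ·L T) a ≈L ((δ̂ S a ·L T) ∪L (iL (ô S) ·L δ̂ T a))
  δ̂-·L S T a w = mk⇔ to from
    where
    δ-word-at : Word X → Lang X
    δ-word-at s = δ-word s a

    to : w ∈ δ̂ (S ·L T) a → w ∈ (δ̂ S a ·L T) ∪L (iL (ô S) ·L δ̂ T a)
    to w∈ with ∈-concatMap⁻′ δ-word-at w∈
    ... | _ , st∈ , w∈δst with ∈-·L⁻ {S = S} st∈
    ... | s , t , s∈S , t∈T , refl
        with ∈-++⁻ (δ-word s a ·L ⟦ t ⟧) (subst (w ∈_) (δ-word-++ s t a) w∈δst)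
    ... | inj₁ w∈δs·t with ∈-·L⁻ {S = δ-word s a} w∈δs·t
    ... | v , _ , v∈δs , here refl , refl =
          ∈-++⁺ˡ (∈-·L⁺ (∈-concatMap⁺′ δ-word-at s∈S v∈δs) t∈T)
    to w∈ | _ | s , t , s∈S , t∈T , refl | inj₂ w∈iL·δt with ∈-iL-·L⁻ {b = ô-word s} w∈iL·δt
    ... | s-accepting , w∈δt =
          ∈-++⁺ʳ (δ̂ S a ·L T) (∈-iL-·L⁺ (T-ô⁺ s∈S s-accepting) (∈-concatMap⁺′ δ-word-at t∈T w∈δt))

    from : w ∈ (δ̂ S a ·L T) ∪L (iL (ô S) ·L δ̂ T a) → w ∈ δ̂ (S ·L T) a
    from w∈ with ∈-++⁻ (δ̂ S a ·L T) w∈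
    ... | inj₁ w∈δS·T with ∈-·L⁻ {S = δ̂ S a} w∈δS·T
    ... | v , t , v∈δS , t∈T , refl with ∈-concatMap⁻′ δ-word-at {xs = S} v∈δS
    ... | s , s∈S , v∈δs = ∈-concatMap⁺′ δ-word-at {xs = S ·L T} (∈-·L⁺ s∈S t∈T)
          (subst (v ++ t ∈_) (sym (δ-word-++ s t a)) (∈-++⁺ˡ (∈-·L⁺ v∈δs (here refl))))
    from w∈ | inj₂ w∈iL·δT with ∈-iL-·L⁻ {b = ô S} w∈iL·δT
    ... | S-accepting , w∈δT with T-ô⁻ S S-accepting | ∈-concatMap⁻′ δ-word-at {xs = T} w∈δT
    ... | s , s∈S , s-accepting | t , t∈T , w∈δt = ∈-concatMap⁺′ δ-word-at {xs = S ·L T} (∈-·L⁺ s∈S t∈T)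
          (subst (w ∈_) (sym (δ-word-++ s t a))
            (∈-++⁺ʳ (δ-word s a ·L ⟦ t ⟧) (∈-iL-·L⁺ s-accepting w∈δt)))

proposition3p2 : {A X : Set} → Finite A →
    (o : X → Bool) (δ : X → A → Lang X) →
    (S T : Lang X) (a : A) →
    (Extension.ô {A} o δ (S ·L T) ≡ (Extension.ô {A} o δ S ∧ Extension.ô {A} o δ T))
    × (Extension.δ̂ o δ (S ·L T) a
    ≈L ((Extension.δ̂ o δ S a ·L T) ∪L (iL (Extension.ô {A} o δ S) ·L Extension.δ̂ o δ T a)))
proposition3p2 {A} _ o δ S T a = ô-·L {A} o δ S T , δ̂-·L o δ S T a
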